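{- Let $x \geq 2$ be even, let $T$ be a modified row-sum matrix $\mathrm{MRSM}_{\mathbb{Z}_6}(S,t,x;\Sigma)$, and suppose that the entries $(d_1,\dots,d_x)$ of some row $\alpha$ of $T$ sum to $d \pmod 6$ with $d$ even. Let $G[\Delta]$ be the subgraph of $G = K_{(6:x)}$ determined by row $\alpha$. Then the graph $G[\Delta] \cup \bigcup_{k=1}^{x} G_{i_k}[f_1 \cup f_2]$ has a decomposition into two $2x$-cycle factors.
   Context: For a group $\Gamma$, a subset $S \subseteq \Gamma$, integers $t \geq 1$, $x \geq 2$, and a $t$-list $\Sigma$ of elements of $\Gamma$, a modified row-sum matrix $\mathrm{MRSM}_\Gamma(S,t,x;\Sigma)$ is a $t \times x$ matrix with entries in $\Gamma$ whose $i$-th column is an ordering of some $t$-element subset $S_i \subseteq S$, and whose list of left-to-right row sums is $\Sigma$. $G = K_{(6:x)}$ is the complete equipartite graph with parts $G_0,\dots,G_{x-1}$, part $G_i$ having vertex set $\{(i,j): j \in \mathbb{Z}_6\}$. The columns of $T$ are associated with the consecutive pairs $(i_1,i_2),(i_2,i_3),\dots,(i_x,i_1)$ of a fixed Hamilton cycle $(i_1,\dots,i_x)$ on the part indices $\{0,\dots,x-1\}$. For a row $(d_1,\dots,d_x)$, $G[\Delta]$ is the subgraph of $G$ with edge set $\bigcup_{k=1}^x \{\{(i_k,j),(i_{k+1},j+d_k)\}: j \in \mathbb{Z}_6\}$ (with $i_{x+1} = i_1$). On the vertex set $\{0,1,\dots,5\}$ of $K_6$, define the 1-factors $f_1 = \{\{0,1\},\{2,3\},\{4,5\}\}$,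 $f_2 = \{\{0,5\},\{1,2\},\{3,4\}\}$, $f_3 = \{\{0,3\},\{1,5\},\{2,4\}\}$, $f_4=\{\{0,4\},\{1,3\},\{2,5\}\}$, $f_5=\{\{0,2\},\{1,4\},\{3,5\}\}$. For a set $X$ of edges of $K_6$, $G_i[X]$ denotes the graph with edges $\{(i,a),(i,b)\}$ for $\{a,b\} \in X$. A $2x$-cycle factor is a spanning subgraph (of the graph being decomposed) each of whose components is a cycle of length $2x$; a decomposition partitions the edge set. -}

module Defs where

open import Data.Nat using (ℕ; zero; suc; _*_; _≥_)
open import Data.Nat.DivMod using (_%_; m%n<n)
import Data.Nat as ℕ
open import Data.Fin using (Fin; toℕ; fromℕ<; zero; suc)
open import Data.Product using (_×_; _,_; ∃; ∃-syntax; Σ-syntax)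
open import Data.Sum using (_⊎_)
open import Relation.Binary.PropositionalEquality using (_≡_; _≢_)
open import Function.Definitions using (Injective)

ℤ₆ : Set
ℤ₆ = Fin 6

_⊕_ : ℤ₆ → ℤ₆ → ℤ₆
a ⊕ b = fromℕ< (m%n<n (toℕ a ℕ.+ toℕ b) 6)

sumℤ₆ : {n : ℕ} → (Fin n → ℤ₆) → ℤ₆
sumℤ₆ {zero} f = zero
sumℤ₆ {suc n} f = f zero ⊕ sumℤ₆ (λ i → f (suc i))

cyc : {n : ℕ} → Fin n → Fin n
cyc {suc n} i = fromℕ< (m%n<n (suc (toℕ i)) (suc n))

-- Modified row-sum matrix MRSM_{ℤ₆}(S,t,x;Σ): a t × x matrix T over ℤ₆ whose
-- i-th column is an ordering of a t-subset of S (entries distinct and in S)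
-- and whose list of row sums is Σ.
record IsMRSM (S : ℤ₆ → Set) (t x : ℕ) (Σ' : Fin t → ℤ₆)
              (T : Fin t → Fin x → ℤ₆) : Set where
  field
    t≥1      : t ≥ 1
    x≥2      : x ≥ 2
    colInS   : ∀ (r : Fin t) (c : Fin x) → S (T r c)
    colDistinct : ∀ (c : Fin x) → Injective _≡_ _≡_ (λ r → T r c)
    rowSums  : ∀ (r : Fin t) → sumℤ₆ (T r) ≡ Σ' r

f₁ : Fin 3 → Fin 6 × Fin 6
f₁ zero = (Data.Fin.# 0 , Data.Fin.# 1)
f₁ (suc zero) = (Data.Fin.# 2 , Data.Fin.# 3)
f₁ (suc (suc zero)) = (Data.Fin.# 4 , Data.Fin.# 5)

f₂ : Fin 3 → Fin 6 × Fin 6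
f₂ zero = (Data.Fin.# 0 , Data.Fin.# 5)
f₂ (suc zero) = (Data.Fin.# 1 , Data.Fin.# 2)
f₂ (suc (suc zero)) = (Data.Fin.# 3 , Data.Fin.# 4)

f₁∪f₂ : Fin 2 → Fin 3 → Fin 6 × Fin 6
f₁∪f₂ zero = f₁
f₁∪f₂ (suc zero) = f₂

-- Vertices of K_(6:x): (part index, element of ℤ₆)
Vert : ℕ → Set
Vert x = Fin x × ℤ₆

-- Edge labels of  G[Δ] ∪ ⋃_k G_{i_k}[f₁ ∪ f₂]  (as a multigraph with labelled edges):
--   inj₁ (k , j)     : edge {(i_k , j) , (i_{k+1} , j + d_k)}
--   inj₂ (i , b , m) : edge m of f_{b+1} inside part G_i
Edge : ℕ → Set
Edge x = (Fin x × ℤ₆) ⊎ (Fin x × Fin 2 × Fin 3)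

-- endpoints; σ k = i_{k+1} gives the Hamilton cycle (i₁,…,i_x), d the row
ends : {x : ℕ} → (σ : Fin x → Fin x) → (d : Fin x → ℤ₆) → Edge x → Vert x × Vert x
ends σ d (Data.Sum.inj₁ (k , j)) = ((σ k , j) , (σ (cyc k) , j ⊕ d k))
ends σ d (Data.Sum.inj₂ (i , b , m)) with f₁∪f₂ b m
... | (a , a') = ((i , a) , (i , a'))

Joins : {V : Set} → V × V → V → V → Set
Joins (a , b) u w = (a ≡ u × b ≡ w) ⊎ (a ≡ w × b ≡ u)

-- An L-cycle factor of the (multi)graph with edges E, endpoints `en`, restricted to
-- the edge set F: F is the edge-disjoint union of vertex-disjoint cycles of length L
-- (each with L distinct vertices) that together cover every vertex.
record CycleFactor {V E : Set} (en : E → V × V) (L : ℕ) (F : E → Set) : Set where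
  field
    r       : ℕ
    vert    : Fin r → Fin L → V
    edge    : Fin r → Fin L → E
    vertInj : ∀ c → Injective _≡_ _≡_ (vert c)
    joins   : ∀ c m → Joins (en (edge c m)) (vert c m) (vert c (cyc m))
    inF     : ∀ c m → F (edge c m)
    vCover  : ∀ v → ∃[ c ] ∃[ m ] vert c m ≡ v
    vDisj   : ∀ c c' m m' → vert c m ≡ vert c' m' → c ≡ c'
    eCover  : ∀ e → F e → ∃[ c ] ∃[ m ] edge c m ≡ e
    eDisj   : ∀ c c' m m' → edge c m ≡ edge c' m' → (c ≡ c' × m ≡ m')

DecompTwoCycleFactors : {V E : Set} → (E → V × V) → ℕ → Set
DecompTwoCycleFactors {E = E} en L =
  Σ[ col ∈ (E → Fin 2) ] (∀ (b : Fin 2) → CycleFactor en L (λ e → col e ≡ b))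

-- Give each position k of the Hamilton cycle a sign ε_k = ±1 such that Σ_k (ε_k + d_k) = 0 in ℤ₆;
-- this is possible because x and Σ_k d_k are even. Let P_k be the suffix sums of ε_k + d_k, so that
-- P_k = ε_k + d_k + P_{k+1} cyclically. For each a ∈ ℤ₆ there is a closed walk which in part i_k
-- runs from a − P_k along the hexagon edge {a − P_k , a − P_k + ε_k} of f₁ ∪ f₂ and then along the
-- difference edge with difference d_k to a − P_{k+1} in part i_{k+1}; it is a 2x-cycle. The walks
-- for the three a of parity b form a 2x-cycle factor, and the factors for b = 0 and b = 1 partition
-- the edges: in each part they use the two complementary perfect matchings of the hexagon.

module Submission where

open import Defs
open import Data.Nat using (ℕ; zero; suc; _+_; _∸_; _*_; _<_; _≥_)
open import Data.Nat.Divisibility using (_∣_; _∣?_; divides)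
open import Data.Nat.DivMod using (_%_; m%n<n; m<n⇒m%n≡m; n%n≡0)
open import Data.Nat.Properties using (1+n≰n; m≤n⇒m<n∨m≡n; *-comm; +-identityʳ)
open import Data.Nat.Tactic.RingSolver using (solve-∀)
open import Data.Fin
  using (Fin; zero; suc; toℕ; fromℕ; fromℕ<; inject₁; punchOut; cast; combine; remQuot)
open import Data.Fin.Patterns using (0F; 1F; 2F; 3F; 4F; 5F)
open import Data.Fin.Properties
  using (all?; any?; _≟_; toℕ-injective; toℕ<n; toℕ-fromℕ<; toℕ-fromℕ; toℕ-inject₁;
         punchOut-injective; injective⇒≤; toℕ-cast; cast-involutive; toℕ-combine;
         remQuot-combine; combine-remQuot)
open import Data.Fin.Relation.Unary.Top using (view; ‵fromℕ; ‵inject₁)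
open import Data.Product using (_×_; _,_; ∃; ∃₂; proj₁; proj₂; uncurry)
import Data.Product as Product
open import Data.Product.Properties using (≡-dec)
open import Data.Sum using (inj₁; inj₂)
open import Data.Sum.Properties using (inj₁-injective; inj₂-injective)
open import Function using (_∘_; _↔_; Inverse; mk↔ₛ′; Injection)
open import Function.Definitions using (Injective)
open import Function.Properties.Inverse using (↔⇒↣)
open import Relation.Binary.PropositionalEquality
  using (_≡_; _≢_; refl; sym; trans; cong; cong₂; subst; module ≡-Reasoning)
open import Relation.Nullary using (Dec; yes; no; contradiction)
open import Relation.Nullary.Decidable using (from-yes; _×-dec_; _⊎-dec_; _→-dec_)

open ≡-Reasoning

_⊖_ : ℤ₆ → ℤ₆ → ℤ₆
a ⊖ b = fromℕ< (m%n<n (toℕ a + (6 ∸ toℕ b)) 6)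

⊕-assoc : ∀ a b c → (a ⊕ b) ⊕ c ≡ a ⊕ (b ⊕ c)
⊕-assoc = from-yes (all? λ a → all? λ b → all? λ c → (a ⊕ b) ⊕ c ≟ a ⊕ (b ⊕ c))

⊕-interchange : ∀ a b c e → (a ⊕ b) ⊕ (c ⊕ e) ≡ (a ⊕ c) ⊕ (b ⊕ e)
⊕-interchange = from-yes (all? λ a → all? λ b → all? λ c → all? λ e →
  (a ⊕ b) ⊕ (c ⊕ e) ≟ (a ⊕ c) ⊕ (b ⊕ e))

⊖-⊕-cancel : ∀ a e S → (a ⊖ (e ⊕ S)) ⊕ e ≡ a ⊖ S
⊖-⊕-cancel = from-yes (all? λ a → all? λ e → all? λ S → (a ⊖ (e ⊕ S)) ⊕ e ≟ a ⊖ S)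

sumℤ₆-⊕ : ∀ {n} (f g : Fin n → ℤ₆) → sumℤ₆ (λ p → f p ⊕ g p) ≡ sumℤ₆ f ⊕ sumℤ₆ g
sumℤ₆-⊕ {zero} f g = refl
sumℤ₆-⊕ {suc n} f g = trans (cong ((f zero ⊕ g zero) ⊕_) (sumℤ₆-⊕ (f ∘ suc) (g ∘ suc)))
  (⊕-interchange (f zero) (g zero) (sumℤ₆ (f ∘ suc)) (sumℤ₆ (g ∘ suc)))

toℕ-cyc : ∀ {n} (i : Fin n) → suc (toℕ i) < n → toℕ (cyc i) ≡ suc (toℕ i)
toℕ-cyc {suc n} i lt = trans (toℕ-fromℕ< _) (m<n⇒m%n≡m lt)

toℕ-cyc-last : ∀ {n} (i : Fin n) → suc (toℕ i) ≡ n → toℕ (cyc i) ≡ 0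
toℕ-cyc-last {suc n} i eq = trans (toℕ-fromℕ< _) (trans (cong (_% suc n) eq) (n%n≡0 (suc n)))

cyc-≡ : ∀ {n} {i j : Fin n} → suc (toℕ i) ≡ toℕ j → cyc i ≡ j
cyc-≡ {i = i} {j} eq = toℕ-injective (trans (toℕ-cyc i (subst (_< _) (sym eq) (toℕ<n j))) eq)

suffixSum : ∀ {n} → (Fin n → ℤ₆) → Fin n → ℤ₆
suffixSum f zero = sumℤ₆ f
suffixSum f (suc i) = suffixSum (f ∘ suc) i

suffixSum-inject₁ : ∀ {n} (f : Fin (suc n) → ℤ₆) (i : Fin n) →
  suffixSum f (inject₁ i) ≡ f (inject₁ i) ⊕ suffixSum f (suc i)
suffixSum-inject₁ f zero = refl
suffixSum-inject₁ f (suc i) = suffixSum-inject₁ (f ∘ suc) i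

suffixSum-fromℕ : ∀ {n} (f : Fin (suc n) → ℤ₆) → suffixSum f (fromℕ n) ≡ f (fromℕ n) ⊕ zero
suffixSum-fromℕ {zero} f = refl
suffixSum-fromℕ {suc n} f = suffixSum-fromℕ (f ∘ suc)

suffixSum-cyc : ∀ {n} (f : Fin (suc n) → ℤ₆) → sumℤ₆ f ≡ zero →
  ∀ p → suffixSum f p ≡ f p ⊕ suffixSum f (cyc p)
suffixSum-cyc {n} f total p with view p
... | ‵fromℕ = begin
  suffixSum f (fromℕ n)                     ≡⟨ suffixSum-fromℕ f ⟩
  f (fromℕ n) ⊕ zero                        ≡⟨ cong (f (fromℕ n) ⊕_) total ⟨
  f (fromℕ n) ⊕ suffixSum f zero
    ≡⟨ cong (λ q → f (fromℕ n) ⊕ suffixSum f q) cyc-fromℕ ⟨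
  f (fromℕ n) ⊕ suffixSum f (cyc (fromℕ n)) ∎
  where
  cyc-fromℕ : cyc (fromℕ n) ≡ zero
  cyc-fromℕ = toℕ-injective (toℕ-cyc-last (fromℕ n) (cong suc (toℕ-fromℕ n)))
... | ‵inject₁ i = begin
  suffixSum f (inject₁ i)                       ≡⟨ suffixSum-inject₁ f i ⟩
  f (inject₁ i) ⊕ suffixSum f (suc i)
    ≡⟨ cong (λ q → f (inject₁ i) ⊕ suffixSum f q) cyc-inject₁ ⟨
  f (inject₁ i) ⊕ suffixSum f (cyc (inject₁ i)) ∎
  where
  cyc-inject₁ : cyc (inject₁ i) ≡ suc i
  cyc-inject₁ = cyc-≡ (cong suc (toℕ-inject₁ i))

signed : Fin 2 → ℤ₆
signed 0F = 1F
signed 1F = 5F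

alternating : ∀ {n} → Fin n → Fin 2
alternating 0F = 0F
alternating 1F = 1F
alternating (suc (suc i)) = alternating i

sum-alternating : ∀ q → sumℤ₆ {q * 2} (signed ∘ alternating) ≡ zero
sum-alternating zero = refl
sum-alternating (suc q) = cong (λ s → signed 0F ⊕ (signed 1F ⊕ s)) (sum-alternating q)

openingSigns : ℤ₆ → Fin 2 × Fin 2
openingSigns 2F = 1F , 1F
openingSigns 4F = 0F , 0F
openingSigns _  = 0F , 1F

openingSigns-balance : ∀ D → 2 ∣ toℕ D →
  (signed (proj₁ (openingSigns D)) ⊕ (signed (proj₂ (openingSigns D)) ⊕ 0F)) ⊕ D ≡ 0F
openingSigns-balance = from-yes (all? λ D → 2 ∣? toℕ D →-dec
  (signed (proj₁ (openingSigns D)) ⊕ (signed (proj₂ (openingSigns D)) ⊕ 0F)) ⊕ D ≟ 0F)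

balancingSigns : ∀ {n} → ℤ₆ → Fin (2 + n) → Fin 2
balancingSigns D 0F = proj₁ (openingSigns D)
balancingSigns D 1F = proj₂ (openingSigns D)
balancingSigns D (suc (suc i)) = alternating i

sum-balancingSigns : ∀ q D → 2 ∣ toℕ D → sumℤ₆ (signed ∘ balancingSigns {q * 2} D) ⊕ D ≡ zero
sum-balancingSigns q D D-even =
  trans (cong (λ s → (signed (proj₁ (openingSigns D)) ⊕ (signed (proj₂ (openingSigns D)) ⊕ s)) ⊕ D)
              (sum-alternating q))
        (openingSigns-balance D D-even)

parity : ℤ₆ → Fin 2
parity a = fromℕ< (m%n<n (toℕ a) 2)

_⊻_ : Fin 2 → Fin 2 → Fin 2
0F ⊻ b = b
1F ⊻ 0F = 1F
1F ⊻ 1F = 0F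

-- the edge {a , a ⊕ 1} of the hexagon f₁ ∪ f₂ = (0 1 2 3 4 5)
hexagonEdge : ℤ₆ → Fin 2 × Fin 3
hexagonEdge 0F = 0F , 0F
hexagonEdge 1F = 1F , 1F
hexagonEdge 2F = 0F , 1F
hexagonEdge 3F = 1F , 2F
hexagonEdge 4F = 0F , 2F
hexagonEdge 5F = 1F , 0F

hexagonStep : ℤ₆ → Fin 2 → Fin 2 × Fin 3
hexagonStep a 0F = hexagonEdge a
hexagonStep a 1F = hexagonEdge (a ⊕ signed 1F)

-- The c-th walk of colour b passes a part with potential S and sign t at level 0 and then, one
-- hexagon step further, at level 1; combine c b = 2c + b runs over the elements of parity b.
level : Fin 2 → Fin 3 → ℤ₆ → Fin 2 → Fin 2 → ℤ₆
level b c S t 0F = combine c b ⊖ S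
level b c S t 1F = level b c S t 0F ⊕ signed t

-- Level-0 values of colour b have parity b ⊻ parity S, level-1 values the other parity. The
-- hexagon edge (f , m) is {y , y ⊕ 1} with parity y ≡ f, and a walk runs through it from y
-- if t ≡ 0F and from y ⊕ 1 if t ≡ 1F.
colourDiff : ℤ₆ → ℤ₆ → Fin 2
colourDiff S j = (parity j ⊻ parity S) ⊻ 1F

colourHex : ℤ₆ → Fin 2 → Fin 2 × Fin 3 → Fin 2
colourHex S t (f , _) = (f ⊻ parity S) ⊻ t

joins? : (p : ℤ₆ × ℤ₆) (u w : ℤ₆) → Dec (Joins p u w)
joins? (a , b) u w = (a ≟ u ×-dec b ≟ w) ⊎-dec (a ≟ w ×-dec b ≟ u)

_≟₂₃_ : (g h : Fin 2 × Fin 3) → Dec (g ≡ h)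
_≟₂₃_ = ≡-dec _≟_ _≟_

hexagonStep-joins : ∀ a t → Joins (uncurry f₁∪f₂ (hexagonStep a t)) a (a ⊕ signed t)
hexagonStep-joins = from-yes (all? λ a → all? λ t →
  joins? (uncurry f₁∪f₂ (hexagonStep a t)) a (a ⊕ signed t))

level-injective : ∀ b c c' S t u u' → level b c S t u ≡ level b c' S t u' → c ≡ c' × u ≡ u'
level-injective = from-yes (all? λ b → all? λ c → all? λ c' → all? λ S → all? λ t →
  all? λ u → all? λ u' → level b c S t u ≟ level b c' S t u' →-dec (c ≟ c' ×-dec u ≟ u'))

level-surjective : ∀ b S t j → ∃₂ λ c u → level b c S t u ≡ j
level-surjective = from-yes (all? λ b → all? λ S → all? λ t → all? λ j →
  any? λ c → any? λ u → level b c S t u ≟ j)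

hexagonStep-level-injective : ∀ b c c' S t →
  hexagonStep (level b c S t 0F) t ≡ hexagonStep (level b c' S t 0F) t → c ≡ c'
hexagonStep-level-injective = from-yes (all? λ b → all? λ c → all? λ c' → all? λ S → all? λ t →
  hexagonStep (level b c S t 0F) t ≟₂₃ hexagonStep (level b c' S t 0F) t →-dec c ≟ c')

colourHex-level : ∀ b c S t → colourHex S t (hexagonStep (level b c S t 0F) t) ≡ b
colourHex-level = from-yes (all? λ b → all? λ c → all? λ S → all? λ t →
  colourHex S t (hexagonStep (level b c S t 0F) t) ≟ b)

colourDiff-level : ∀ b c S t → colourDiff S (level b c S t 1F) ≡ b
colourDiff-level = from-yes (all? λ b → all? λ c → all? λ S → all? λ t →
  colourDiff S (level b c S t 1F) ≟ b)

colourHex-level⁻¹ : ∀ b S t f m → colourHex S t (f , m) ≡ b →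
  ∃ λ c → hexagonStep (level b c S t 0F) t ≡ (f , m)
colourHex-level⁻¹ = from-yes (all? λ b → all? λ S → all? λ t → all? λ f → all? λ m →
  colourHex S t (f , m) ≟ b →-dec any? λ c → hexagonStep (level b c S t 0F) t ≟₂₃ (f , m))

colourDiff-level⁻¹ : ∀ b S t j → colourDiff S j ≡ b → ∃ λ c → level b c S t 1F ≡ j
colourDiff-level⁻¹ = from-yes (all? λ b → all? λ S → all? λ t → all? λ j →
  colourDiff S j ≟ b →-dec any? λ c → level b c S t 1F ≟ j)

injective⇒surjective : ∀ {n} {σ : Fin n → Fin n} → Injective _≡_ _≡_ σ → ∀ i → ∃ λ p → σ p ≡ i
injective⇒surjective {suc n} {σ} σ-injective i with any? (λ p → σ p ≟ i)
... | yes found = found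
... | no missed = contradiction (injective⇒≤ punched-injective) 1+n≰n
  where
  i≢σ : ∀ p → i ≢ σ p
  i≢σ p eq = missed (p , sym eq)

  punched-injective : Injective _≡_ _≡_ (λ p → punchOut (i≢σ p))
  punched-injective {p} {q} eq = σ-injective (punchOut-injective (i≢σ p) (i≢σ q) eq)

injective⇒↔ : ∀ {n} (σ : Fin n → Fin n) → Injective _≡_ _≡_ σ → Fin n ↔ Fin n
injective⇒↔ σ σ-injective = mk↔ₛ′ σ (proj₁ ∘ surjective) (proj₂ ∘ surjective)
  (λ p → σ-injective (proj₂ (surjective (σ p))))
  where surjective = injective⇒surjective σ-injective

Joins-map : ∀ {A B : Set} (h : A → B) {p : A × A} {u w : A} →
  Joins p u w → Joins (Product.map h h p) (h u) (h w)
Joins-map h (inj₁ (refl , refl)) = inj₁ (refl , refl)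
Joins-map h (inj₂ (refl , refl)) = inj₂ (refl , refl)

record CycleLabelling {V E : Set} (en : E → V × V) (F : E → Set) (I : Set) (next : I → I) :
       Set where
  field
    r                 : ℕ
    vertex            : Fin r → I → V
    edge              : Fin r → I → E
    vertex-injective  : ∀ c c' s s' → vertex c s ≡ vertex c' s' → c ≡ c' × s ≡ s'
    edge-injective    : ∀ c c' s s' → edge c s ≡ edge c' s' → c ≡ c' × s ≡ s'
    vertex-surjective : ∀ v → ∃₂ λ c s → vertex c s ≡ v
    edge-surjective   : ∀ e → F e → ∃₂ λ c s → edge c s ≡ e
    joins             : ∀ c s → Joins (en (edge c s)) (vertex c s) (vertex c (next s))
    edge∈F            : ∀ c s → F (edge c s)

cycleFactor : ∀ {V E I : Set} {en : E → V × V} {F : E → Set} {next : I → I} {L : ℕ}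
  (pos : Fin L ↔ I) → (∀ m → Inverse.to pos (cyc m) ≡ next (Inverse.to pos m)) →
  CycleLabelling en F I next → CycleFactor en L F
cycleFactor {en = en} pos pos-cyc labelling = record
  { r       = r
  ; vert    = λ c m → vertex c (to m)
  ; edge    = λ c m → edge c (to m)
  ; vertInj = λ c {m} {m'} eq → to-injective (proj₂ (vertex-injective c c (to m) (to m') eq))
  ; joins   = λ c m → subst (Joins (en (edge c (to m))) (vertex c (to m)))
                            (cong (vertex c) (sym (pos-cyc m))) (joins c (to m))
  ; inF     = λ c m → edge∈F c (to m)
  ; vCover  = λ v → let c , s , eq = vertex-surjective v in
                    c , from s , trans (cong (vertex c) (strictlyInverseˡ s)) eq
  ; vDisj   = λ c c' m m' eq → proj₁ (vertex-injective c c' (to m) (to m') eq)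
  ; eCover  = λ e e∈F → let c , s , eq = edge-surjective e e∈F in
                        c , from s , trans (cong (edge c) (strictlyInverseˡ s)) eq
  ; eDisj   = λ c c' m m' eq → Product.map₂ to-injective (edge-injective c c' (to m) (to m') eq)
  }
  where
  open CycleLabelling labelling
  open Inverse pos using (to; from; strictlyInverseˡ)
  to-injective : Injective _≡_ _≡_ to
  to-injective = Injection.injective (↔⇒↣ pos)

next : ∀ {n} → Fin n × Fin 2 → Fin n × Fin 2
next (k , 0F) = k , 1F
next (k , 1F) = cyc k , 0F

interleave⁻¹ : ∀ {n} → Fin n × Fin 2 → Fin (2 * n)
interleave⁻¹ {n} (k , u) = cast (*-comm n 2) (combine k u)

-- position 2k + u of a cycle of length 2n corresponds to (k , u)
interleave : ∀ {n} → Fin (2 * n) ↔ (Fin n × Fin 2)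
interleave {n} = mk↔ₛ′ (remQuot 2 ∘ cast (*-comm 2 n)) interleave⁻¹
  (λ (k , u) → trans (cong (remQuot 2) (cast-involutive (*-comm 2 n) (*-comm n 2) (combine k u)))
                      (remQuot-combine k u))
  (λ m → trans (cong (cast (*-comm n 2)) (combine-remQuot {n} 2 (cast (*-comm 2 n) m)))
               (cast-involutive (*-comm n 2) (*-comm 2 n) m))

toℕ-interleave⁻¹ : ∀ {n} (k : Fin n) u → toℕ (interleave⁻¹ (k , u)) ≡ 2 * toℕ k + toℕ u
toℕ-interleave⁻¹ k u = trans (toℕ-cast _ (combine k u)) (toℕ-combine k u)

private
  suc[2a+0]≡2a+1 : ∀ a → suc (2 * a + 0) ≡ 2 * a + 1
  suc[2a+0]≡2a+1 = solve-∀

  suc[2a+1]≡2[1+a] : ∀ a → suc (2 * a + 1) ≡ 2 * suc a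
  suc[2a+1]≡2[1+a] = solve-∀

cyc-interleave⁻¹ : ∀ {n} (s : Fin n × Fin 2) → cyc (interleave⁻¹ s) ≡ interleave⁻¹ (next s)
cyc-interleave⁻¹ (k , 0F) = cyc-≡ (begin
  suc (toℕ (interleave⁻¹ (k , 0F))) ≡⟨ cong suc (toℕ-interleave⁻¹ k 0F) ⟩
  suc (2 * toℕ k + 0)               ≡⟨ suc[2a+0]≡2a+1 (toℕ k) ⟩
  2 * toℕ k + 1                     ≡⟨ toℕ-interleave⁻¹ k 1F ⟨
  toℕ (interleave⁻¹ (k , 1F))       ∎)
cyc-interleave⁻¹ {n} (k , 1F) with m≤n⇒m<n∨m≡n (toℕ<n k)
... | inj₁ k+1<n = cyc-≡ (begin
  suc (toℕ (interleave⁻¹ (k , 1F))) ≡⟨ cong suc (toℕ-interleave⁻¹ k 1F) ⟩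
  suc (2 * toℕ k + 1)               ≡⟨ suc[2a+1]≡2[1+a] (toℕ k) ⟩
  2 * suc (toℕ k)                   ≡⟨ cong (2 *_) (toℕ-cyc k k+1<n) ⟨
  2 * toℕ (cyc k)                   ≡⟨ +-identityʳ _ ⟨
  2 * toℕ (cyc k) + 0               ≡⟨ toℕ-interleave⁻¹ (cyc k) 0F ⟨
  toℕ (interleave⁻¹ (cyc k , 0F))   ∎)
... | inj₂ k+1≡n = toℕ-injective (begin
  toℕ (cyc (interleave⁻¹ (k , 1F))) ≡⟨ toℕ-cyc-last (interleave⁻¹ (k , 1F)) wraps ⟩
  0                                 ≡⟨ cong (λ a → 2 * a + 0) (toℕ-cyc-last k k+1≡n) ⟨
  2 * toℕ (cyc k) + 0               ≡⟨ toℕ-interleave⁻¹ (cyc k) 0F ⟨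
  toℕ (interleave⁻¹ (cyc k , 0F))   ∎)
  where
  wraps : suc (toℕ (interleave⁻¹ (k , 1F))) ≡ 2 * n
  wraps = begin
    suc (toℕ (interleave⁻¹ (k , 1F))) ≡⟨ cong suc (toℕ-interleave⁻¹ k 1F) ⟩
    suc (2 * toℕ k + 1)               ≡⟨ suc[2a+1]≡2[1+a] (toℕ k) ⟩
    2 * suc (toℕ k)                   ≡⟨ cong (2 *_) k+1≡n ⟩
    2 * n                             ∎

interleave-cyc : ∀ {n} (m : Fin (2 * n)) →
  Inverse.to interleave (cyc m) ≡ next (Inverse.to interleave m)
interleave-cyc {n} m = begin
  to (cyc m)               ≡⟨ cong (to ∘ cyc) (strictlyInverseʳ m) ⟨
  to (cyc (from (to m)))   ≡⟨ cong to (cyc-interleave⁻¹ (to m)) ⟩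
  to (from (next (to m)))  ≡⟨ strictlyInverseˡ (next (to m)) ⟩
  next (to m)              ∎
  where open Inverse (interleave {n}) using (to; from; strictlyInverseˡ; strictlyInverseʳ)

module _ {X : ℕ} (π : Fin X ↔ Fin X) (d : Fin X → ℤ₆) (sign : Fin X → Fin 2) (P : Fin X → ℤ₆)
         (P-step : ∀ k → P k ≡ (signed (sign k) ⊕ d k) ⊕ P (cyc k)) where

  open Inverse π using (to; from; strictlyInverseˡ; strictlyInverseʳ)

  private
    to-injective : Injective _≡_ _≡_ to
    to-injective = Injection.injective (↔⇒↣ π)

  colour : Edge X → Fin 2
  colour (inj₁ (k , j)) = colourDiff (P k) j
  colour (inj₂ (i , g)) = colourHex (P (from i)) (sign (from i)) g

  module _ (b : Fin 2) where

    value : Fin 3 → Fin X → Fin 2 → ℤ₆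
    value c k = level b c (P k) (sign k)

    walkVertex : Fin 3 → Fin X × Fin 2 → Vert X
    walkVertex c (k , u) = to k , value c k u

    walkEdge : Fin 3 → Fin X × Fin 2 → Edge X
    walkEdge c (k , 0F) = inj₂ (to k , hexagonStep (value c k 0F) (sign k))
    walkEdge c (k , 1F) = inj₁ (k , value c k 1F)

    walkVertex-injective : ∀ c c' s s' → walkVertex c s ≡ walkVertex c' s' → c ≡ c' × s ≡ s'
    walkVertex-injective c c' (k , u) (k' , u') eq with refl ← to-injective (cong proj₁ eq) =
      Product.map₂ (cong (k ,_)) (level-injective b c c' (P k) (sign k) u u' (cong proj₂ eq))

    walkEdge-injective : ∀ c c' s s' → walkEdge c s ≡ walkEdge c' s' → c ≡ c' × s ≡ s'
    walkEdge-injective c c' (k , 0F) (k' , 0F) eq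
      with refl ← to-injective (cong proj₁ (inj₂-injective eq)) =
      hexagonStep-level-injective b c c' (P k) (sign k) (cong proj₂ (inj₂-injective eq)) , refl
    walkEdge-injective c c' (k , 1F) (k' , 1F) eq with refl ← cong proj₁ (inj₁-injective eq) =
      proj₁ (level-injective b c c' (P k) (sign k) 1F 1F (cong proj₂ (inj₁-injective eq))) , refl
    walkEdge-injective c c' (k , 0F) (k' , 1F) ()
    walkEdge-injective c c' (k , 1F) (k' , 0F) ()

    walkVertex-surjective : ∀ v → ∃₂ λ c s → walkVertex c s ≡ v
    walkVertex-surjective (i , j) =
      let c , u , eq = level-surjective b (P (from i)) (sign (from i)) j in
      c , (from i , u) , cong₂ _,_ (strictlyInverseˡ i) eq

    walkEdge-surjective : ∀ e → colour e ≡ b → ∃₂ λ c s → walkEdge c s ≡ e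
    walkEdge-surjective (inj₁ (k , j)) coloured =
      let c , eq = colourDiff-level⁻¹ b (P k) (sign k) j coloured in
      c , (k , 1F) , cong (λ j → inj₁ (k , j)) eq
    walkEdge-surjective (inj₂ (i , f , m)) coloured =
      let c , eq = colourHex-level⁻¹ b (P (from i)) (sign (from i)) f m coloured in
      c , (from i , 0F) , cong₂ (λ i g → inj₂ (i , g)) (strictlyInverseˡ i) eq

    walk-joins : ∀ c s → Joins (ends to d (walkEdge c s)) (walkVertex c s) (walkVertex c (next s))
    walk-joins c (k , 0F) = Joins-map (to k ,_) (hexagonStep-joins (value c k 0F) (sign k))
    walk-joins c (k , 1F) = inj₁ (refl , cong (to (cyc k) ,_) (begin
      ((a ⊖ P k) ⊕ ε) ⊕ d k                    ≡⟨ ⊕-assoc (a ⊖ P k) ε (d k) ⟩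
      (a ⊖ P k) ⊕ (ε ⊕ d k)                    ≡⟨ cong (λ S → (a ⊖ S) ⊕ (ε ⊕ d k)) (P-step k) ⟩
      (a ⊖ ((ε ⊕ d k) ⊕ P (cyc k))) ⊕ (ε ⊕ d k) ≡⟨ ⊖-⊕-cancel a (ε ⊕ d k) (P (cyc k)) ⟩
      a ⊖ P (cyc k)                            ∎))
      where
      a = combine c b
      ε = signed (sign k)

    walk-coloured : ∀ c s → colour (walkEdge c s) ≡ b
    walk-coloured c (k , 0F) rewrite strictlyInverseʳ k = colourHex-level b c (P k) (sign k)
    walk-coloured c (k , 1F) = colourDiff-level b c (P k) (sign k)

    colourClass : CycleLabelling (ends to d) (λ e → colour e ≡ b) (Fin X × Fin 2) next
    colourClass = record
      { r                 = 3
      ; vertex            = walkVertex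
      ; edge              = walkEdge
      ; vertex-injective  = walkVertex-injective
      ; edge-injective    = walkEdge-injective
      ; vertex-surjective = walkVertex-surjective
      ; edge-surjective   = walkEdge-surjective
      ; joins             = walk-joins
      ; edge∈F            = walk-coloured
      }

  twoFactorDecomposition : DecompTwoCycleFactors (ends to d) (2 * X)
  twoFactorDecomposition = colour , λ b → cycleFactor interleave interleave-cyc (colourClass b)

lemma3 : (x : ℕ) → x ≥ 2 → 2 ∣ x →
    (S : ℤ₆ → Set) (t : ℕ) (Σ' : Fin t → ℤ₆) (T : Fin t → Fin x → ℤ₆) →
    IsMRSM S t x Σ' T →
    (σ : Fin x → Fin x) → Injective _≡_ _≡_ σ →
    (α : Fin t) → 2 ∣ toℕ (sumℤ₆ (T α)) →
    DecompTwoCycleFactors (ends σ (T α)) (2 * x)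
lemma3 _ () (divides zero refl) _ _ _ _ _ _ _ _ _
lemma3 _ _ (divides (suc q) refl) S t Σ' T _ σ σ-injective α D-even =
  twoFactorDecomposition (injective⇒↔ σ σ-injective) d sign (suffixSum e) (suffixSum-cyc e total)
  where
  d : Fin (suc q * 2) → ℤ₆
  d = T α
  sign : Fin (suc q * 2) → Fin 2
  sign = balancingSigns (sumℤ₆ d)
  e : Fin (suc q * 2) → ℤ₆
  e p = signed (sign p) ⊕ d p
  total : sumℤ₆ e ≡ zero
  total = trans (sumℤ₆-⊕ (signed ∘ sign) d) (sum-balancingSigns q (sumℤ₆ d) D-even)
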